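{- Let $m \geq 3$ and $n \geq 2$ be integers, and let $k\ge 1$ and $h\ge 0$ be integers with $n=k^2+h$ and $0\le h\le 2k$. Then $\mathrm{sg_e}(P_n \,\square\, K_m) = mk$ if $h=0$; $\mathrm{sg_e}(P_n \,\square\, K_m) = mk + (m-1)$ if $1 \leq h \leq k$; and $\mathrm{sg_e}(P_n \,\square\, K_m) = mk + m$ if $k+1 \leq h \leq 2k$.
   Context: All graphs are finite and simple. $P_n$ is the path on $n$ vertices and $K_m$ the complete graph on $m$ vertices. The Cartesian product $G\,\square\,H$ has vertex set $V(G)\times V(H)$, with $(g,h)$ and $(g',h')$ adjacent iff either $g=g'$ and $hh'\in E(H)$, or $h=h'$ and $gg'\in E(G)$. For a graph $G$, a set $S\subseteq V(G)$ is a strong edge geodetic set if to each (unordered) pair of vertices $x,y\in S$ one can assign one shortest $x,y$-path (or no path) such that every edge of $G$ lies on at least one of the assigned paths; $\mathrm{sg_e}(G)$ is the minimum cardinality of such a set. -}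

module Defs where

open import Data.Nat using (ℕ; zero; suc; _+_; _<_; _≤_)
open import Data.Fin using (Fin; toℕ)
open import Data.Product using (_×_; _,_; Σ; ∃; ∃-syntax)
open import Data.Sum using (_⊎_; inj₁; inj₂)
open import Data.Maybe using (Maybe; just; nothing)
open import Data.List using (List; length; lookup)
open import Data.List.Relation.Unary.Unique.Propositional using (Unique)
open import Relation.Binary.PropositionalEquality using (_≡_; _≢_; sym)
open import Relation.Nullary using (¬_)

record Graph : Set₁ where
  field
    V      : Set
    Adj    : V → V → Set
    symm   : ∀ {x y} → Adj x y → Adj y x
    irrefl : ∀ {x} → ¬ Adj x x
open Graph public

P : ℕ → Graph
P n = record
  { V = Fin n
  ; Adj = λ i j → (suc (toℕ i) ≡ toℕ j) ⊎ (suc (toℕ j) ≡ toℕ i)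
  ; symm = λ { (Data.Sum.inj₁ e) → Data.Sum.inj₂ e ; (Data.Sum.inj₂ e) → Data.Sum.inj₁ e }
  ; irrefl = irr }
  where
  open import Data.Nat.Properties using (1+n≢n)
  open import Relation.Binary.PropositionalEquality using (sym)
  irr : ∀ {x : Fin n} → ¬ ((suc (toℕ x) ≡ toℕ x) ⊎ (suc (toℕ x) ≡ toℕ x))
  irr {x} (Data.Sum.inj₁ e) = 1+n≢n e
  irr {x} (Data.Sum.inj₂ e) = 1+n≢n e

K : ℕ → Graph
K m = record
  { V = Fin m
  ; Adj = λ i j → i ≢ j
  ; symm = λ ne e → ne (Relation.Binary.PropositionalEquality.sym e)
  ; irrefl = λ ne → ne Relation.Binary.PropositionalEquality.refl }

□Adj : (G H : Graph) → V G × V H → V G × V H → Set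
□Adj G H (g , h) (g' , h') = ((g ≡ g') × Adj H h h') ⊎ ((h ≡ h') × Adj G g g')

□symm : (G H : Graph) → ∀ {x y} → □Adj G H x y → □Adj G H y x
□symm G H {g , h} {g' , h'} (inj₁ (e , a)) = inj₁ (sym e , symm H a)
□symm G H {g , h} {g' , h'} (inj₂ (e , a)) = inj₂ (sym e , symm G a)

□irrefl : (G H : Graph) → ∀ {x} → ¬ □Adj G H x x
□irrefl G H {g , h} (inj₁ (_ , a)) = irrefl H a
□irrefl G H {g , h} (inj₂ (_ , a)) = irrefl G a

_□_ : Graph → Graph → Graph
G □ H = record { V = V G × V H ; Adj = □Adj G H ; symm = □symm G H ; irrefl = □irrefl G H }

data Walk (G : Graph) : V G → V G → ℕ → Set where
  []   : ∀ {x} → Walk G x x 0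
  step : ∀ {x y z ℓ} → Adj G x y → Walk G y z ℓ → Walk G x z (suc ℓ)

IsShortest : (G : Graph) {x y : V G} {ℓ : ℕ} → Walk G x y ℓ → Set
IsShortest G {x} {y} {ℓ} _ = ∀ {ℓ'} → Walk G x y ℓ' → ℓ ≤ ℓ'

data EdgeOn (G : Graph) (u v : V G) : ∀ {x y ℓ} → Walk G x y ℓ → Set where
  hereʳ : ∀ {z ℓ} (a : Adj G u v) (w : Walk G v z ℓ) → EdgeOn G u v (step {x = u} {y = v} a w)
  hereˡ : ∀ {z ℓ} (a : Adj G v u) (w : Walk G u z ℓ) → EdgeOn G u v (step {x = v} {y = u} a w)
  there : ∀ {x y z ℓ} (a : Adj G x y) {w : Walk G y z ℓ} → EdgeOn G u v w → EdgeOn G u v (step a w)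

PathBetween : (G : Graph) → V G → V G → Set
PathBetween G x y = Σ ℕ (λ ℓ → Walk G x y ℓ)

-- S (a duplicate-free list of vertices) is a strong edge geodetic set: to each unordered
-- pair {S_i, S_j} (i < j) one assigns one shortest path or no path, such that every edge
-- of G lies on at least one assigned path.
IsStrongEdgeGeodetic : (G : Graph) → List (V G) → Set
IsStrongEdgeGeodetic G S =
  Unique S ×
  Σ ((i j : Fin (length S)) → toℕ i < toℕ j → Maybe (PathBetween G (lookup S i) (lookup S j)))
    (λ f →
      (∀ i j (lt : toℕ i < toℕ j) (p : PathBetween G (lookup S i) (lookup S j)) →
         f i j lt ≡ just p → IsShortest G (Data.Product.proj₂ p))
      ×
      (∀ u v → Adj G u v →
         ∃[ i ] ∃[ j ] Σ (toℕ i < toℕ j) λ lt → Σ (PathBetween G (lookup S i) (lookup S j)) λ p →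
           (f i j lt ≡ just p) × EdgeOn G u v (Data.Product.proj₂ p)))

SgeIs : (G : Graph) → ℕ → Set
SgeIs G s =
  (Σ (List (V G)) λ S → IsStrongEdgeGeodetic G S × (length S ≡ s))
  × (∀ S → IsStrongEdgeGeodetic G S → s ≤ length S)

-- Call c the colour of the vertex (i , c) of P_n □ K_m. A shortest path changes colour at most once, so for
-- colours a ≠ b the n edges (l , a) (l , b) lie on paths joining n distinct pairs (a-vertex, b-vertex) of S;
-- hence the colour counts of S satisfy s_a s_b ≥ n. By AM-GM, s_a s_b ≥ k², > k², > k² + k force s_a + s_b to be
-- at least 2k, 2k + 1, 2k + 2 in the three cases. So either every s_c reaches k (resp. k + 1, k + 1), or some
-- smaller s_t forces every other count up to that sum minus s_t; summing over the colours gives the lower bound.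
-- For the upper bound each colour gets r slots in rows 0, w + 1, 2(w + 1), … (the last slot in the top row).
-- Slots p and q of different colours are joined by a shortest path changing colour in row p w + q, and these
-- rows exhaust the path; the vertical edges of a colour lie on the path between its first and last slot.
module Submission where

open import Defs
open import Data.Nat using (ℕ; zero; suc; _+_; _*_; _∸_; _≤_; _<_; z≤n; s≤s; ∣_-_∣; _⊓_; NonZero; _≟_; _≤?_; _<?_)
open import Data.Nat.Properties
open import Data.Nat.DivMod using (_/_; _%_; m≡m%n+[m/n]*n; m%n<n)
open import Data.Nat.ListAction using (sum)
open import Data.Nat.Tactic.RingSolver using (solve-∀)
open import Data.Fin using (Fin; zero; suc; toℕ; fromℕ; fromℕ<; cast; combine; remQuot; inject≤) renaming (_≟_ to _≟ᶠ_)
open import Data.Fin.Properties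
  using (toℕ-injective; toℕ-fromℕ; toℕ-fromℕ<; toℕ<n; toℕ-cast; cast-involutive; toℕ-inject≤; injective⇒≤;
         combine-injective; remQuot-combine; combine-remQuot; toℕ-combine)
import Data.Fin.Properties as Fin
open import Data.Product using (_×_; _,_; Σ; Σ-syntax; ∃-syntax; proj₁; proj₂; uncurry)
open import Data.Sum using (_⊎_; inj₁; inj₂)
open import Data.Maybe using (Maybe; just)
open import Data.Maybe.Properties using (just-injective)
open import Data.List using (List; []; _∷_; length; lookup; map; tabulate; allFin)
open import Data.List.Properties using (∷-injective; length-map; length-tabulate; lookup-tabulate)
open import Data.List.Membership.Propositional using (_∈_)
open import Data.List.Relation.Unary.Any using (here; there)
open import Data.List.Relation.Unary.All as All using (All; []; _∷_)
open import Data.List.Relation.Unary.AllPairs as AllPairs using (AllPairs; []; _∷_)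
import Data.List.Relation.Unary.AllPairs.Properties as AllPairsₚ
open import Data.List.Relation.Unary.Unique.Propositional using (Unique)
open import Data.List.Relation.Unary.Unique.Propositional.Properties using (allFin⁺; tabulate⁺)
open import Function using (_∘_; id)
open import Function.Definitions using (Injective)
open import Relation.Binary using (tri<; tri≈; tri>)
open import Relation.Binary.PropositionalEquality
open import Relation.Nullary using (¬_; yes; no; contradiction)

length*≤sum : ∀ {b} (L : List ℕ) → All (b ≤_) L → length L * b ≤ sum L
length*≤sum []      []          = z≤n
length*≤sum (x ∷ L) (b≤x ∷ b≤L) = +-mono-≤ b≤x (length*≤sum L b≤L)

4x[x+d]≤[2x+d]² : ∀ x d → 4 * (x * (x + d)) ≤ (x + (x + d)) * (x + (x + d))
4x[x+d]≤[2x+d]² x d = subst (4 * (x * (x + d)) ≤_) (expand x d) (m≤m+n _ (d * d))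
  where
  expand : ∀ x d → 4 * (x * (x + d)) + d * d ≡ (x + (x + d)) * (x + (x + d))
  expand = solve-∀

4xy≤[x+y]²-ordered : ∀ {x y} → x ≤ y → 4 * (x * y) ≤ (x + y) * (x + y)
4xy≤[x+y]²-ordered {x} {y} x≤y =
  subst (λ z → 4 * (x * z) ≤ (x + z) * (x + z)) (m+[n∸m]≡n x≤y) (4x[x+d]≤[2x+d]² x (y ∸ x))

4xy≤[x+y]² : ∀ x y → 4 * (x * y) ≤ (x + y) * (x + y)
4xy≤[x+y]² x y with ≤-total x y
... | inj₁ x≤y = 4xy≤[x+y]²-ordered x≤y
... | inj₂ y≤x = subst₂ _≤_ (cong (4 *_) (*-comm y x)) (cong (λ z → z * z) (+-comm y x)) (4xy≤[x+y]²-ordered y≤x)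

s²<4xy⇒s<x+y : ∀ {s} x y → s * s < 4 * (x * y) → s < x + y
s²<4xy⇒s<x+y {s} x y s²<4xy with s <? x + y
... | yes s<x+y = s<x+y
... | no s≮x+y = contradiction s²<4xy (≤⇒≯ (≤-trans (4xy≤[x+y]² x y) (*-mono-≤ x+y≤s x+y≤s)))
  where
  x+y≤s : x + y ≤ s
  x+y≤s = ≮⇒≥ s≮x+y

m+n≡o⇒m≤o : ∀ {m n o} → m + n ≡ o → m ≤ o
m+n≡o⇒m≤o {m} {n} refl = m≤m+n m n

m+1+n≡o⇒m<o : ∀ {m n o} → m + suc n ≡ o → m < o
m+1+n≡o⇒m<o {m} refl = m<m+n m (s≤s z≤n)

s²<4N∧N≤xy⇒s<x+y : ∀ {s N} x y → s * s < 4 * N → N ≤ x * y → s < x + y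
s²<4N∧N≤xy⇒s<x+y x y s²<4N N≤xy = s²<4xy⇒s<x+y x y (<-≤-trans s²<4N (*-monoʳ-≤ 4 N≤xy))

r*v+u≤t+r*[v+u∸t] : ∀ {r v u t} → 1 ≤ r → t ≤ u → r * v + u ≤ t + r * ((v + u) ∸ t)
r*v+u≤t+r*[v+u∸t] {r} {v} {u} {t} 1≤r t≤u = begin
  r * v + u                    ≡⟨ cong (r * v +_) (sym (m+[n∸m]≡n t≤u)) ⟩
  r * v + (t + (u ∸ t))        ≡⟨ rearrange (r * v) t (u ∸ t) ⟩
  t + (r * v + 1 * (u ∸ t))    ≤⟨ +-monoʳ-≤ t (+-monoʳ-≤ (r * v) (*-monoˡ-≤ (u ∸ t) 1≤r)) ⟩
  t + (r * v + r * (u ∸ t))    ≡⟨ cong (t +_) (sym (*-distribˡ-+ r v (u ∸ t))) ⟩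
  t + r * (v + (u ∸ t))        ≡⟨ cong (λ z → t + r * z) (sym (+-∸-assoc v t≤u)) ⟩
  t + r * ((v + u) ∸ t)        ∎
  where
  open ≤-Reasoning
  rearrange : ∀ a b c → a + (b + c) ≡ b + (a + 1 * c)
  rearrange = solve-∀

module _ {n c d : ℕ} (bound : ∀ {t y} → t < c → n ≤ t * y → d ≤ t + y) where

  small-entry-or-all-≥ : (L : List ℕ) → AllPairs (λ x y → n ≤ x * y) L →
    All (c ≤_) L ⊎ Σ ℕ λ t → t ∈ L × t < c × Σ ℕ λ r → length L ≡ suc r × t + r * (d ∸ t) ≤ sum L
  small-entry-or-all-≥ [] [] = inj₁ []
  small-entry-or-all-≥ (x ∷ L) (x·L ∷ pairs) with x <? c
  ... | yes x<c = inj₂ (x , here refl , x<c , length L , refl ,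
    +-monoʳ-≤ x (length*≤sum L (All.map (λ n≤xy → m≤n+o⇒m∸n≤o d x (bound x<c n≤xy)) x·L)))
  ... | no x≮c with small-entry-or-all-≥ L pairs
  ...   | inj₁ c≤L = inj₁ (≮⇒≥ x≮c ∷ c≤L)
  ...   | inj₂ (t , t∈L , t<c , r , |L| , le) = inj₂ (t , there t∈L , t<c , suc r , cong suc |L| , bound-with-x)
    where
    open ≤-Reasoning
    d∸t≤x : d ∸ t ≤ x
    d∸t≤x = m≤n+o⇒m∸n≤o d t (bound t<c (subst (n ≤_) (*-comm x t) (All.lookup x·L t∈L)))
    bound-with-x : t + (d ∸ t + r * (d ∸ t)) ≤ x + sum L
    bound-with-x = begin
      t + (d ∸ t + r * (d ∸ t))  ≡⟨ +-comm-middle t (d ∸ t) _ ⟩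
      d ∸ t + (t + r * (d ∸ t))  ≤⟨ +-mono-≤ d∸t≤x le ⟩
      x + sum L                  ∎
      where
      +-comm-middle : ∀ a b c → a + (b + c) ≡ b + (a + c)
      +-comm-middle = solve-∀

sum-≥-of-pairwise-products : ∀ {n c r v u} → 1 ≤ r → v ≤ c → u ≤ c → c ≤ suc u →
  (∀ {t y} → t < c → n ≤ t * y → v + u ≤ t + y) →
  (L : List ℕ) → length L ≡ suc r → AllPairs (λ x y → n ≤ x * y) L → r * v + u ≤ sum L
sum-≥-of-pairwise-products {c = c} {r} {v} {u} 1≤r v≤c u≤c c≤1+u bound L |L| pairs
  with small-entry-or-all-≥ bound L pairs
... | inj₁ c≤L = begin
  r * v + u       ≤⟨ +-mono-≤ (*-monoʳ-≤ r v≤c) u≤c ⟩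
  r * c + c       ≡⟨ +-comm (r * c) c ⟩
  suc r * c       ≡⟨ cong (_* c) (sym |L|) ⟩
  length L * c    ≤⟨ length*≤sum L c≤L ⟩
  sum L           ∎
  where open ≤-Reasoning
... | inj₂ (t , _ , t<c , r′ , |L|′ , le) with trans (sym |L|) |L|′
...   | refl = ≤-trans (r*v+u≤t+r*[v+u∸t] 1≤r (≤-pred (≤-trans t<c c≤1+u))) le

∣n-1+n∣≡1 : ∀ t → ∣ t - suc t ∣ ≡ 1
∣n-1+n∣≡1 t = trans (cong (∣ t -_∣) (+-comm 1 t)) (∣m-m+n∣≡n t 1)

Between : ℕ → ℕ → ℕ → Set
Between i g j = (i ≤ g × g ≤ j) ⊎ (j ≤ g × g ≤ i)

∣-∣-additive-between : ∀ i g j → Between i g j → ∣ i - g ∣ + ∣ g - j ∣ ≡ ∣ i - j ∣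
∣-∣-additive-between i g j (inj₁ (i≤g , g≤j)) = begin
  ∣ i - g ∣ + ∣ g - j ∣ ≡⟨ cong₂ _+_ (m≤n⇒∣m-n∣≡n∸m i≤g) (m≤n⇒∣m-n∣≡n∸m g≤j) ⟩
  (g ∸ i) + (j ∸ g)     ≡⟨ +-cancelˡ-≡ i _ _ telescope ⟩
  j ∸ i                 ≡⟨ sym (m≤n⇒∣m-n∣≡n∸m (≤-trans i≤g g≤j)) ⟩
  ∣ i - j ∣             ∎
  where
  open ≡-Reasoning
  telescope : i + ((g ∸ i) + (j ∸ g)) ≡ i + (j ∸ i)
  telescope = begin
    i + ((g ∸ i) + (j ∸ g)) ≡⟨ sym (+-assoc i (g ∸ i) (j ∸ g)) ⟩
    i + (g ∸ i) + (j ∸ g)   ≡⟨ cong (_+ (j ∸ g)) (m+[n∸m]≡n i≤g) ⟩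
    g + (j ∸ g)             ≡⟨ m+[n∸m]≡n g≤j ⟩
    j                       ≡⟨ sym (m+[n∸m]≡n (≤-trans i≤g g≤j)) ⟩
    i + (j ∸ i)             ∎
∣-∣-additive-between i g j (inj₂ between) = begin
  ∣ i - g ∣ + ∣ g - j ∣ ≡⟨ +-comm ∣ i - g ∣ ∣ g - j ∣ ⟩
  ∣ g - j ∣ + ∣ i - g ∣ ≡⟨ cong₂ _+_ (∣-∣-comm g j) (∣-∣-comm i g) ⟩
  ∣ j - g ∣ + ∣ g - i ∣ ≡⟨ ∣-∣-additive-between j g i (inj₁ between) ⟩
  ∣ j - i ∣             ≡⟨ ∣-∣-comm j i ⟩
  ∣ i - j ∣             ∎
  where open ≡-Reasoning

Between-left : ∀ i j → Between i i j
Between-left i j with ≤-total i j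
... | inj₁ i≤j = inj₁ (≤-refl , i≤j)
... | inj₂ j≤i = inj₂ (j≤i , ≤-refl)

Between-⊓ : ∀ {i g j} t → Between i g j → Between (i ⊓ t) (g ⊓ t) (j ⊓ t)
Between-⊓ t (inj₁ (i≤g , g≤j)) = inj₁ (⊓-monoˡ-≤ t i≤g , ⊓-monoˡ-≤ t g≤j)
Between-⊓ t (inj₂ (j≤g , g≤i)) = inj₂ (⊓-monoˡ-≤ t j≤g , ⊓-monoˡ-≤ t g≤i)

∈∧length≤1⇒singleton : ∀ {A : Set} {L : List A} {t} → length L ≤ 1 → t ∈ L → L ≡ t ∷ []
∈∧length≤1⇒singleton {L = _ ∷ []}    _         (here refl) = refl
∈∧length≤1⇒singleton {L = _ ∷ _ ∷ _} (s≤s ()) _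

SgeWitness : Graph → ℕ → Set
SgeWitness G s = Σ (List (V G)) λ S → IsStrongEdgeGeodetic G S × length S ≡ s

SgeLowerBound : Graph → ℕ → Set
SgeLowerBound G s = ∀ S → IsStrongEdgeGeodetic G S → s ≤ length S

module _ {G : Graph} where

  infixr 5 _++ᵂ_
  _++ᵂ_ : ∀ {x y z a b} → Walk G x y a → Walk G y z b → Walk G x z (a + b)
  []       ++ᵂ w′ = w′
  step e w ++ᵂ w′ = step e (w ++ᵂ w′)

  EdgeOn-++ʳ : ∀ {u v x y z a b} (w : Walk G x y a) {w′ : Walk G y z b} → EdgeOn G u v w′ → EdgeOn G u v (w ++ᵂ w′)
  EdgeOn-++ʳ []         o = o
  EdgeOn-++ʳ (step e w) o = there e (EdgeOn-++ʳ w o)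

  EdgeOn-sym : ∀ {u v x y ℓ} {w : Walk G x y ℓ} → EdgeOn G u v w → EdgeOn G v u w
  EdgeOn-sym (hereʳ e w) = hereˡ e w
  EdgeOn-sym (hereˡ e w) = hereʳ e w
  EdgeOn-sym (there e o) = there e (EdgeOn-sym o)

tabulate-isStrongEdgeGeodetic : (G : Graph) {s : ℕ} (g : Fin s → V G) → Injective _≡_ _≡_ g →
  (path : (i j : Fin s) → PathBetween G (g i) (g j)) → (∀ i j → IsShortest G (proj₂ (path i j))) →
  (∀ u v → Adj G u v → Σ[ i ∈ Fin s ] Σ[ j ∈ Fin s ] toℕ i < toℕ j × EdgeOn G u v (proj₂ (path i j))) →
  IsStrongEdgeGeodetic G (tabulate g)
tabulate-isStrongEdgeGeodetic G {s} g g-inj path shortest covers =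
  tabulate⁺ g-inj , assign , assign-shortest , assign-covers
  where
  S : List (V G)
  S = tabulate g
  |S| : length S ≡ s
  |S| = length-tabulate g

  lookup≡g : ∀ i → lookup S i ≡ g (cast |S| i)
  lookup≡g i = trans (cong (lookup S) (sym (cast-involutive (sym |S|) |S| i))) (lookup-tabulate g (cast |S| i))

  transport : ∀ {x x′ y y′} → x′ ≡ x → y′ ≡ y → PathBetween G x y → PathBetween G x′ y′
  transport refl refl p = p

  transport-shortest : ∀ {x x′ y y′} (ex : x′ ≡ x) (ey : y′ ≡ y) (p : PathBetween G x y) →
    IsShortest G (proj₂ p) → IsShortest G (proj₂ (transport ex ey p))
  transport-shortest refl refl p sh = sh

  transport-edge : ∀ {x x′ y y′ u v} (ex : x′ ≡ x) (ey : y′ ≡ y) (p : PathBetween G x y) →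
    EdgeOn G u v (proj₂ p) → EdgeOn G u v (proj₂ (transport ex ey p))
  transport-edge refl refl p o = o

  assign : (i j : Fin (length S)) → toℕ i < toℕ j → Maybe (PathBetween G (lookup S i) (lookup S j))
  assign i j _ = just (transport (lookup≡g i) (lookup≡g j) (path (cast |S| i) (cast |S| j)))

  assign-shortest : ∀ i j (lt : toℕ i < toℕ j) p → assign i j lt ≡ just p → IsShortest G (proj₂ p)
  assign-shortest i j lt p eq with just-injective eq
  ... | refl = transport-shortest (lookup≡g i) (lookup≡g j) _ (shortest _ _)

  uncast : ∀ i → cast |S| (cast (sym |S|) i) ≡ i
  uncast i = cast-involutive |S| (sym |S|) i

  edge-uncast : ∀ {u v} i j → EdgeOn G u v (proj₂ (path i j)) →
    EdgeOn G u v (proj₂ (path (cast |S| (cast (sym |S|) i)) (cast |S| (cast (sym |S|) j))))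
  edge-uncast {u} {v} i j o = subst₂ (λ i′ j′ → EdgeOn G u v (proj₂ (path i′ j′))) (sym (uncast i)) (sym (uncast j)) o

  assign-covers : ∀ u v → Adj G u v → ∃[ i ] ∃[ j ] Σ (toℕ i < toℕ j) λ lt →
    Σ (PathBetween G (lookup S i) (lookup S j)) λ p → (assign i j lt ≡ just p) × EdgeOn G u v (proj₂ p)
  assign-covers u v e with covers u v e
  ... | i , j , i<j , o =
    cast (sym |S|) i , cast (sym |S|) j ,
    subst₂ _<_ (sym (toℕ-cast (sym |S|) i)) (sym (toℕ-cast (sym |S|) j)) i<j ,
    _ , refl , transport-edge (lookup≡g _) (lookup≡g _) _ (edge-uncast i j o)

module PathTimesComplete (n m : ℕ) where

  G : Graph
  G = P n □ K m

  Vertex : Set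
  Vertex = Fin n × Fin m

  row : Vertex → ℕ
  row = toℕ ∘ proj₁

  colour : Vertex → Fin m
  colour = proj₂

  -- (i , c , d): a step from colour c to colour d inside row i.
  Crossing : Set
  Crossing = Fin n × Fin m × Fin m

  crossings : ∀ {x y ℓ} → Walk G x y ℓ → List Crossing
  crossings [] = []
  crossings (step {x = i , c} {y = _ , d} (inj₁ _) w) = (i , c , d) ∷ crossings w
  crossings (step (inj₂ _) w) = crossings w

  ∣-∣≡1-if-P-adjacent : ∀ {i j : Fin n} → Adj (P n) i j → ∣ toℕ i - toℕ j ∣ ≡ 1
  ∣-∣≡1-if-P-adjacent {i} (inj₁ e) rewrite sym e = ∣n-1+n∣≡1 (toℕ i)
  ∣-∣≡1-if-P-adjacent {_} {j} (inj₂ e) rewrite sym e = trans (∣-∣-comm (suc (toℕ j)) (toℕ j)) (∣n-1+n∣≡1 (toℕ j))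

  ∣row-row∣+crossings≤length : ∀ {x y ℓ} (w : Walk G x y ℓ) → ∣ row x - row y ∣ + length (crossings w) ≤ ℓ
  ∣row-row∣+crossings≤length {x} [] rewrite ∣n-n∣≡0 (row x) = z≤n
  ∣row-row∣+crossings≤length {_} {y} (step {y = x′} (inj₁ (refl , _)) w)
    rewrite +-suc ∣ row x′ - row y ∣ (length (crossings w)) = s≤s (∣row-row∣+crossings≤length w)
  ∣row-row∣+crossings≤length {x} {y} (step {y = x′} (inj₂ (_ , adj)) w) = begin
    ∣ row x - row y ∣ + L                       ≤⟨ +-monoˡ-≤ L (∣-∣-triangle (row x) (row x′) (row y)) ⟩
    ∣ row x - row x′ ∣ + ∣ row x′ - row y ∣ + L ≡⟨ cong (λ d → d + ∣ row x′ - row y ∣ + L) (∣-∣≡1-if-P-adjacent adj) ⟩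
    suc (∣ row x′ - row y ∣ + L)                ≤⟨ s≤s (∣row-row∣+crossings≤length w) ⟩
    _                                           ∎
    where
    open ≤-Reasoning
    L : ℕ
    L = length (crossings w)

  no-crossings⇒same-colour : ∀ {x y ℓ} (w : Walk G x y ℓ) → crossings w ≡ [] → colour x ≡ colour y
  no-crossings⇒same-colour [] _ = refl
  no-crossings⇒same-colour (step (inj₂ (e , _)) w) eq = trans e (no-crossings⇒same-colour w eq)

  one-crossing⇒end-colours : ∀ {x y ℓ} (w : Walk G x y ℓ) {l c d} → crossings w ≡ (l , c , d) ∷ [] →
    colour x ≡ c × colour y ≡ d
  one-crossing⇒end-colours (step (inj₁ _) w) eq with ∷-injective eq
  ... | refl , rest = refl , sym (no-crossings⇒same-colour w rest)
  one-crossing⇒end-colours (step (inj₂ (e , _)) w) eq with one-crossing⇒end-colours w eq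
  ... | c≡ , d≡ = trans e c≡ , d≡

  layer-edge-on⇒crossing : ∀ {x y ℓ} (w : Walk G x y ℓ) {l : Fin n} {a b : Fin m} → EdgeOn G (l , a) (l , b) w →
    ((l , a , b) ∈ crossings w) ⊎ ((l , b , a) ∈ crossings w)
  layer-edge-on⇒crossing _ (hereʳ (inj₁ _) w) = inj₁ (here refl)
  layer-edge-on⇒crossing _ (hereʳ (inj₂ (_ , adj)) w) = contradiction adj (irrefl (P n))
  layer-edge-on⇒crossing _ (hereˡ (inj₁ _) w) = inj₂ (here refl)
  layer-edge-on⇒crossing _ (hereˡ (inj₂ (_ , adj)) w) = contradiction adj (irrefl (P n))
  layer-edge-on⇒crossing _ (there (inj₁ _) {w} o) with layer-edge-on⇒crossing w o
  ... | inj₁ c∈ = inj₁ (there c∈)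
  ... | inj₂ c∈ = inj₂ (there c∈)
  layer-edge-on⇒crossing _ (there (inj₂ _) {w} o) = layer-edge-on⇒crossing w o

  next-row<n : ∀ (i : Fin n) d (j : Fin n) → toℕ i + suc d ≡ toℕ j → suc (toℕ i) < n
  next-row<n i d j e = ≤-<-trans (subst (suc (toℕ i) ≤_) (trans (sym (+-suc (toℕ i) d)) e) (s≤s (m≤m+n (toℕ i) d))) (toℕ<n j)

  ascend : (c : Fin m) (i : Fin n) (d : ℕ) (j : Fin n) → toℕ i + d ≡ toℕ j → Walk G (i , c) (j , c) d
  ascend c i zero j e with toℕ-injective {i = i} {j = j} (trans (sym (+-identityʳ _)) e)
  ... | refl = []
  ascend c i (suc d) j e = step (inj₂ (refl , inj₁ (sym (toℕ-fromℕ< i+1<n))))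
    (ascend c (fromℕ< i+1<n) d j (trans (cong (_+ d) (toℕ-fromℕ< i+1<n)) (trans (sym (+-suc (toℕ i) d)) e)))
    where
    i+1<n : suc (toℕ i) < n
    i+1<n = next-row<n i d j e

  ascend-covers : ∀ c i d j e (g g′ : Fin n) → toℕ i ≤ toℕ g → suc (toℕ g) ≡ toℕ g′ → toℕ g′ ≤ toℕ j →
    EdgeOn G (g , c) (g′ , c) (ascend c i d j e)
  ascend-covers c i zero j e g g′ i≤g g+1≡g′ g′≤j with toℕ-injective {i = i} {j = j} (trans (sym (+-identityʳ _)) e)
  ... | refl = contradiction (≤-trans (subst (suc (toℕ i) ≤_) g+1≡g′ (s≤s i≤g)) g′≤j) (<-irrefl refl)
  ascend-covers c i (suc d) j e g g′ i≤g g+1≡g′ g′≤j with toℕ i ≟ toℕ g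
  ... | no i≢g = there _ (ascend-covers c _ d j _ g g′ (subst (_≤ toℕ g) (sym (toℕ-fromℕ< i+1<n)) (≤∧≢⇒< i≤g i≢g)) g+1≡g′ g′≤j)
    where
    i+1<n : suc (toℕ i) < n
    i+1<n = next-row<n i d j e
  ... | yes i≡g with toℕ-injective {i = i} {j = g} i≡g
                   | toℕ-injective {i = g′} {j = fromℕ< (next-row<n i d j e)}
                       (trans (sym g+1≡g′) (trans (cong suc (sym i≡g)) (sym (toℕ-fromℕ< (next-row<n i d j e)))))
  ...   | refl | refl = hereʳ _ _

  prev-row<n : ∀ (i : Fin n) d (j : Fin n) → toℕ j + suc d ≡ toℕ i → toℕ j + d < n
  prev-row<n i d j e = ≤-trans (≤-reflexive (trans (sym (+-suc (toℕ j) d)) e)) (<⇒≤ (toℕ<n i))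

  descend : (c : Fin m) (i : Fin n) (d : ℕ) (j : Fin n) → toℕ j + d ≡ toℕ i → Walk G (i , c) (j , c) d
  descend c i zero j e with toℕ-injective {i = j} {j = i} (trans (sym (+-identityʳ _)) e)
  ... | refl = []
  descend c i (suc d) j e =
    step (inj₂ (refl , inj₂ (trans (cong suc (toℕ-fromℕ< j+d<n)) (trans (sym (+-suc (toℕ j) d)) e))))
         (descend c (fromℕ< j+d<n) d j (sym (toℕ-fromℕ< j+d<n)))
    where
    j+d<n : toℕ j + d < n
    j+d<n = prev-row<n i d j e

  descend-covers : ∀ c i d j e (g g′ : Fin n) → toℕ j ≤ toℕ g → suc (toℕ g) ≡ toℕ g′ → toℕ g′ ≤ toℕ i →
    EdgeOn G (g , c) (g′ , c) (descend c i d j e)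
  descend-covers c i zero j e g g′ j≤g g+1≡g′ g′≤i with toℕ-injective {i = j} {j = i} (trans (sym (+-identityʳ _)) e)
  ... | refl = contradiction (≤-trans (subst (suc (toℕ j) ≤_) g+1≡g′ (s≤s j≤g)) g′≤i) (<-irrefl refl)
  descend-covers c i (suc d) j e g g′ j≤g g+1≡g′ g′≤i with toℕ g′ ≟ toℕ i
  ... | no g′≢i = there _ (descend-covers c _ d j _ g g′ j≤g g+1≡g′ (≤-pred (subst (suc (toℕ g′) ≤_) i≡1+prev (≤∧≢⇒< g′≤i g′≢i))))
    where
    i≡1+prev : toℕ i ≡ suc (toℕ (fromℕ< (prev-row<n i d j e)))
    i≡1+prev = trans (sym e) (trans (+-suc (toℕ j) d) (cong suc (sym (toℕ-fromℕ< (prev-row<n i d j e)))))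
  ... | yes g′≡i with toℕ-injective {i = g′} {j = i} g′≡i
                   | toℕ-injective {i = g} {j = fromℕ< (prev-row<n i d j e)}
                       (suc-injective (trans g+1≡g′ (trans g′≡i (trans (sym e) (trans (+-suc (toℕ j) d)
                         (cong suc (sym (toℕ-fromℕ< (prev-row<n i d j e)))))))))
  ...   | refl | refl = hereˡ _ _

  vertical : (c : Fin m) (i j : Fin n) → PathBetween G (i , c) (j , c)
  vertical c i j with ≤-total (toℕ i) (toℕ j)
  ... | inj₁ i≤j = toℕ j ∸ toℕ i , ascend c i _ j (m+[n∸m]≡n i≤j)
  ... | inj₂ j≤i = toℕ i ∸ toℕ j , descend c i _ j (m+[n∸m]≡n j≤i)

  vertical-length : ∀ c i j → proj₁ (vertical c i j) ≡ ∣ toℕ i - toℕ j ∣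
  vertical-length c i j with ≤-total (toℕ i) (toℕ j)
  ... | inj₁ i≤j = sym (m≤n⇒∣m-n∣≡n∸m i≤j)
  ... | inj₂ j≤i = sym (m≤n⇒∣n-m∣≡n∸m j≤i)

  vertical-covers : ∀ c i j (g g′ : Fin n) → suc (toℕ g) ≡ toℕ g′ →
    (toℕ i ≤ toℕ g × toℕ g′ ≤ toℕ j) ⊎ (toℕ j ≤ toℕ g × toℕ g′ ≤ toℕ i) →
    EdgeOn G (g , c) (g′ , c) (proj₂ (vertical c i j))
  vertical-covers c i j g g′ g+1≡g′ between with ≤-total (toℕ i) (toℕ j) | between
  ... | inj₁ _   | inj₁ (i≤g , g′≤j) = ascend-covers c i _ j _ g g′ i≤g g+1≡g′ g′≤j
  ... | inj₂ _   | inj₂ (j≤g , g′≤i) = descend-covers c i _ j _ g g′ j≤g g+1≡g′ g′≤i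
  ... | inj₁ i≤j | inj₂ (j≤g , g′≤i) =
    contradiction (≤-trans (subst (suc (toℕ i) ≤_) g+1≡g′ (s≤s (≤-trans i≤j j≤g))) g′≤i) (<-irrefl refl)
  ... | inj₂ j≤i | inj₁ (i≤g , g′≤j) =
    contradiction (≤-trans (subst (suc (toℕ j) ≤_) g+1≡g′ (s≤s (≤-trans j≤i i≤g))) g′≤j) (<-irrefl refl)

  crossing : ∀ {c d : Fin m} (i l j : Fin n) → c ≢ d → PathBetween G (i , c) (j , d)
  crossing {c} {d} i l j c≢d =
    _ , proj₂ (vertical c i l) ++ᵂ step (inj₁ (refl , c≢d)) (proj₂ (vertical d l j))

  crossing-length : ∀ {c d} (i l j : Fin n) (c≢d : c ≢ d) → Between (toℕ i) (toℕ l) (toℕ j) →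
    proj₁ (crossing i l j c≢d) ≡ suc ∣ toℕ i - toℕ j ∣
  crossing-length {c} {d} i l j _ between = begin
    proj₁ (vertical c i l) + suc (proj₁ (vertical d l j)) ≡⟨ cong₂ (λ a b → a + suc b) (vertical-length c i l) (vertical-length d l j) ⟩
    ∣ toℕ i - toℕ l ∣ + suc ∣ toℕ l - toℕ j ∣               ≡⟨ +-suc _ _ ⟩
    suc (∣ toℕ i - toℕ l ∣ + ∣ toℕ l - toℕ j ∣)             ≡⟨ cong suc (∣-∣-additive-between _ _ _ between) ⟩
    suc ∣ toℕ i - toℕ j ∣                                  ∎
    where open ≡-Reasoning

  crossing-covers-switch : ∀ {c d} (i l j : Fin n) (c≢d : c ≢ d) → EdgeOn G (l , c) (l , d) (proj₂ (crossing i l j c≢d))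
  crossing-covers-switch {c} i l j _ = EdgeOn-++ʳ (proj₂ (vertical c i l)) (hereʳ _ _)

  crossing-covers-second-leg : ∀ {c d} (i l j : Fin n) (c≢d : c ≢ d) (g g′ : Fin n) → suc (toℕ g) ≡ toℕ g′ →
    (toℕ l ≤ toℕ g × toℕ g′ ≤ toℕ j) ⊎ (toℕ j ≤ toℕ g × toℕ g′ ≤ toℕ l) →
    EdgeOn G (g , d) (g′ , d) (proj₂ (crossing i l j c≢d))
  crossing-covers-second-leg {c} {d} i l j _ g g′ g+1≡g′ between =
    EdgeOn-++ʳ (proj₂ (vertical c i l)) (there _ (vertical-covers d l j g g′ g+1≡g′ between))

  -- Every walk needs ∣ i - j ∣ vertical steps, and at least one crossing when the colours differ.
  vertical-shortest : ∀ {i j : Fin n} {c : Fin m} {ℓ} (p : Walk G (i , c) (j , c) ℓ) → ℓ ≤ ∣ toℕ i - toℕ j ∣ → IsShortest G p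
  vertical-shortest p ℓ≤ w = ≤-trans ℓ≤ (≤-trans (m≤m+n _ _) (∣row-row∣+crossings≤length w))

  crossing-shortest : ∀ {i j : Fin n} {c d : Fin m} {ℓ} (p : Walk G (i , c) (j , d) ℓ) → c ≢ d → ℓ ≤ suc ∣ toℕ i - toℕ j ∣ →
    IsShortest G p
  crossing-shortest {i} {j} p c≢d ℓ≤ {ℓ′} w = begin
    _                                       ≤⟨ ℓ≤ ⟩
    suc ∣ toℕ i - toℕ j ∣                   ≡⟨ +-comm 1 _ ⟩
    ∣ toℕ i - toℕ j ∣ + 1                   ≤⟨ +-monoʳ-≤ ∣ toℕ i - toℕ j ∣ (crosses w) ⟩
    ∣ toℕ i - toℕ j ∣ + length (crossings w) ≤⟨ ∣row-row∣+crossings≤length w ⟩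
    ℓ′                                      ∎
    where
    open ≤-Reasoning
    crosses : ∀ {ℓ″} (w : Walk G (i , _) (j , _) ℓ″) → 1 ≤ length (crossings w)
    crosses w with crossings w in eq
    ... | []    = contradiction (no-crossings⇒same-colour w eq) c≢d
    ... | _ ∷ _ = s≤s z≤n

  shortest-crossings-bounded : ∀ {x y ℓ ℓ′ k} (p : Walk G x y ℓ) → IsShortest G p →
    Walk G x y ℓ′ → ℓ′ ≡ ∣ row x - row y ∣ + k → length (crossings p) ≤ k
  shortest-crossings-bounded p shortest w |w| =
    +-cancelˡ-≤ _ _ _ (≤-trans (∣row-row∣+crossings≤length p) (≤-trans (shortest w) (≤-reflexive |w|)))

  shortest⇒crossings≤1 : ∀ {x y ℓ} (p : Walk G x y ℓ) → IsShortest G p → length (crossings p) ≤ 1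
  shortest⇒crossings≤1 {i , c} {j , d} p shortest with c ≟ᶠ d
  ... | yes refl = ≤-trans (shortest-crossings-bounded p shortest (proj₂ (vertical c i j))
                              (trans (vertical-length c i j) (sym (+-identityʳ _)))) z≤n
  ... | no c≢d = shortest-crossings-bounded p shortest (proj₂ (crossing i i j c≢d))
                   (trans (crossing-length i i j c≢d (Between-left _ _)) (+-comm 1 _))

  shortest-layer-edge⇒single-crossing : ∀ {x y ℓ} (p : Walk G x y ℓ) → IsShortest G p →
    ∀ {l a b} → EdgeOn G (l , a) (l , b) p →
    (crossings p ≡ (l , a , b) ∷ []) ⊎ (crossings p ≡ (l , b , a) ∷ [])
  shortest-layer-edge⇒single-crossing p shortest o with layer-edge-on⇒crossing p o
  ... | inj₁ ∈p = inj₁ (∈∧length≤1⇒singleton (shortest⇒crossings≤1 p shortest) ∈p)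
  ... | inj₂ ∈p = inj₂ (∈∧length≤1⇒singleton (shortest⇒crossings≤1 p shortest) ∈p)

  colourCount : Fin m → List Vertex → ℕ
  colourCount c [] = 0
  colourCount c (x ∷ S) with colour x ≟ᶠ c
  ... | yes _ = suc (colourCount c S)
  ... | no _  = colourCount c S

  colourRank : ∀ {c} (S : List Vertex) (k : Fin (length S)) → colour (lookup S k) ≡ c → Fin (colourCount c S)
  colourRank {c} (x ∷ S) k e with colour x ≟ᶠ c
  colourRank (x ∷ S) zero    e | yes _   = zero
  colourRank (x ∷ S) (suc k) e | yes _   = suc (colourRank S k e)
  colourRank (x ∷ S) zero    e | no x≢c = contradiction e x≢c
  colourRank (x ∷ S) (suc k) e | no _    = colourRank S k e

  colourRank-injective : ∀ {c} (S : List Vertex) k k′ e e′ → colourRank {c} S k e ≡ colourRank S k′ e′ → k ≡ k′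
  colourRank-injective {c} (x ∷ S) k k′ e e′ eq with colour x ≟ᶠ c
  colourRank-injective (x ∷ S) zero    zero     e e′ eq | _       = refl
  colourRank-injective (x ∷ S) (suc k) (suc k′) e e′ eq | yes _   = cong suc (colourRank-injective S k k′ e e′ (Fin.suc-injective eq))
  colourRank-injective (x ∷ S) (suc k) (suc k′) e e′ eq | no _    = cong suc (colourRank-injective S k k′ e e′ eq)
  colourRank-injective (x ∷ S) zero    (suc _)  e e′ () | yes _
  colourRank-injective (x ∷ S) (suc _) zero     e e′ () | yes _
  colourRank-injective (x ∷ S) zero    (suc _)  e e′ eq | no x≢c = contradiction e x≢c
  colourRank-injective (x ∷ S) (suc _) zero     e e′ eq | no x≢c = contradiction e′ x≢c

  module _ (S : List Vertex) (geo : IsStrongEdgeGeodetic G S) {a b : Fin m} (a≢b : a ≢ b) where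

    private
      Index : Set
      Index = Fin (length S)

      assign : (i j : Index) → toℕ i < toℕ j → Maybe (PathBetween G (lookup S i) (lookup S j))
      assign = proj₁ (proj₂ geo)

      assign-shortest : ∀ i j lt p → assign i j lt ≡ just p → IsShortest G (proj₂ p)
      assign-shortest = proj₁ (proj₂ (proj₂ geo))

      same-indices⇒same-crossings : ∀ {i j i′ j′} (lt : toℕ i < toℕ j) (lt′ : toℕ i′ < toℕ j′) p p′ →
        assign i j lt ≡ just p → assign i′ j′ lt′ ≡ just p′ → i ≡ i′ → j ≡ j′ →
        crossings (proj₂ p) ≡ crossings (proj₂ p′)
      same-indices⇒same-crossings lt lt′ p p′ e e′ refl refl rewrite <-irrelevant lt lt′
        with just-injective (trans (sym e) e′)
      ... | refl = refl

      module Layer (l : Fin n) where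
        cover : ∃[ i ] ∃[ j ] Σ (toℕ i < toℕ j) λ lt → Σ (PathBetween G (lookup S i) (lookup S j)) λ p →
                  (assign i j lt ≡ just p) × EdgeOn G (l , a) (l , b) (proj₂ p)
        cover = proj₂ (proj₂ (proj₂ geo)) (l , a) (l , b) (inj₁ (refl , a≢b))

        i j : Index
        i = proj₁ cover
        j = proj₁ (proj₂ cover)

        i<j : toℕ i < toℕ j
        i<j = proj₁ (proj₂ (proj₂ cover))

        path : PathBetween G (lookup S i) (lookup S j)
        path = proj₁ (proj₂ (proj₂ (proj₂ cover)))

        assigned : assign i j i<j ≡ just path
        assigned = proj₁ (proj₂ (proj₂ (proj₂ (proj₂ cover))))

        single-crossing : (crossings (proj₂ path) ≡ (l , a , b) ∷ []) ⊎ (crossings (proj₂ path) ≡ (l , b , a) ∷ [])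
        single-crossing = shortest-layer-edge⇒single-crossing (proj₂ path)
          (assign-shortest i j i<j path assigned) (proj₂ (proj₂ (proj₂ (proj₂ (proj₂ cover)))))

        layer-of-path : ∀ {l′ c d} → crossings (proj₂ path) ≡ (l′ , c , d) ∷ [] → l ≡ l′
        layer-of-path eq with single-crossing
        ... | inj₁ eq′ = cong proj₁ (proj₁ (∷-injective (trans (sym eq′) eq)))
        ... | inj₂ eq′ = cong proj₁ (proj₁ (∷-injective (trans (sym eq′) eq)))

        Ends : Set
        Ends = Σ (Index × Index) λ (A , B) → colour (lookup S A) ≡ a × colour (lookup S B) ≡ b ×
                 ((A ≡ i × B ≡ j) ⊎ (A ≡ j × B ≡ i))

        ends : Ends
        ends with single-crossing
        ... | inj₁ eq = let ca , cb = one-crossing⇒end-colours (proj₂ path) eq in (i , j) , ca , cb , inj₁ (refl , refl)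
        ... | inj₂ eq = let cb , ca = one-crossing⇒end-colours (proj₂ path) eq in (j , i) , ca , cb , inj₂ (refl , refl)

      open Layer using (ends)

      same-pair⇒same-layer : ∀ l l′ → Layer.i l ≡ Layer.i l′ → Layer.j l ≡ Layer.j l′ → l ≡ l′
      same-pair⇒same-layer l l′ ii jj = via (Layer.single-crossing l′)
        where
        same : crossings (proj₂ (Layer.path l)) ≡ crossings (proj₂ (Layer.path l′))
        same = same-indices⇒same-crossings (Layer.i<j l) (Layer.i<j l′) _ _ (Layer.assigned l) (Layer.assigned l′) ii jj
        via : _ ⊎ _ → l ≡ l′
        via (inj₁ eq) = Layer.layer-of-path l (trans same eq)
        via (inj₂ eq) = Layer.layer-of-path l (trans same eq)

      ends-injective : ∀ l l′ → proj₁ (ends l) ≡ proj₁ (ends l′) → l ≡ l′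
      ends-injective l l′ eq with ends l | ends l′
      ... | (A , B) , _ , _ , o | (A′ , B′) , _ , _ , o′ with eq | o | o′
      ... | refl | inj₁ (p , q) | inj₁ (p′ , q′) = same-pair⇒same-layer l l′ (trans (sym p) p′) (trans (sym q) q′)
      ... | refl | inj₂ (p , q) | inj₂ (p′ , q′) = same-pair⇒same-layer l l′ (trans (sym q) q′) (trans (sym p) p′)
      ... | refl | inj₁ (p , q) | inj₂ (p′ , q′) =
        contradiction (Layer.i<j l) (<-asym (subst₂ _<_ (cong toℕ (trans (sym q′) q)) (cong toℕ (trans (sym p′) p)) (Layer.i<j l′)))
      ... | refl | inj₂ (p , q) | inj₁ (p′ , q′) =
        contradiction (Layer.i<j l) (<-asym (subst₂ _<_ (cong toℕ (trans (sym p′) p)) (cong toℕ (trans (sym q′) q)) (Layer.i<j l′)))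

    -- The assigned path through (l , a) (l , b) has that edge as its only colour change, so it determines l;
    -- its ends are a vertex of colour a and one of colour b, and l ↦ their ranks is injective.
    layers≤colourCount*colourCount : n ≤ colourCount a S * colourCount b S
    layers≤colourCount*colourCount = injective⇒≤ {f = rankPair} rankPair-injective
      where
      rankPair : Fin n → Fin (colourCount a S * colourCount b S)
      rankPair l = let (A , B) , ca , cb , _ = ends l in combine (colourRank S A ca) (colourRank S B cb)
      rankPair-injective : ∀ {l l′} → rankPair l ≡ rankPair l′ → l ≡ l′
      rankPair-injective {l} {l′} eq with ends l | ends l′ | ends-injective l l′
      ... | (A , B) , ca , cb , _ | (A′ , B′) , ca′ , cb′ , _ | inj with combine-injective _ _ _ _ eq
      ... | rA , rB = inj (cong₂ _,_ (colourRank-injective S A A′ ca ca′ rA) (colourRank-injective S B B′ cb cb′ rB))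

  colourCounts : List (Fin m) → List Vertex → List ℕ
  colourCounts cs S = map (λ c → colourCount c S) cs

  colourCounts-absent : ∀ x S cs → All (colour x ≢_) cs → sum (colourCounts cs (x ∷ S)) ≡ sum (colourCounts cs S)
  colourCounts-absent x S [] [] = refl
  colourCounts-absent x S (c ∷ cs) (x≢c ∷ x≢cs) with colour x ≟ᶠ c
  ... | yes x≡c = contradiction x≡c x≢c
  ... | no _    = cong (colourCount c S +_) (colourCounts-absent x S cs x≢cs)

  colourCounts-∷ : ∀ x S cs → Unique cs → sum (colourCounts cs (x ∷ S)) ≤ suc (sum (colourCounts cs S))
  colourCounts-∷ x S [] [] = z≤n
  colourCounts-∷ x S (c ∷ cs) (c≢cs ∷ distinct) with colour x ≟ᶠ c
  ... | yes refl = s≤s (≤-reflexive (cong (colourCount (colour x) S +_) (colourCounts-absent x S cs c≢cs)))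
  ... | no _     = ≤-trans (+-monoʳ-≤ (colourCount c S) (colourCounts-∷ x S cs distinct)) (≤-reflexive (+-suc _ _))

  sum-colourCounts≤length : ∀ cs S → Unique cs → sum (colourCounts cs S) ≤ length S
  sum-colourCounts≤length cs [] _ = ≤-reflexive (sum-zeros cs)
    where
    sum-zeros : ∀ cs → sum (colourCounts cs []) ≡ 0
    sum-zeros [] = refl
    sum-zeros (_ ∷ cs) = sum-zeros cs
  sum-colourCounts≤length cs (x ∷ S) distinct =
    ≤-trans (colourCounts-∷ x S cs distinct) (s≤s (sum-colourCounts≤length cs S distinct))

  sge-lowerBound : ∀ {r c v u} → m ≡ suc r → 1 ≤ r → v ≤ c → u ≤ c → c ≤ suc u →
    (∀ {t y} → t < c → n ≤ t * y → v + u ≤ t + y) → SgeLowerBound G (r * v + u)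
  sge-lowerBound {r} m≡1+r 1≤r v≤c u≤c c≤1+u bound S geo = begin
    _            ≤⟨ sum-≥-of-pairwise-products 1≤r v≤c u≤c c≤1+u bound counts |counts| pairs ⟩
    sum counts   ≤⟨ sum-colourCounts≤length (allFin m) S (allFin⁺ m) ⟩
    length S     ∎
    where
    open ≤-Reasoning
    counts : List ℕ
    counts = colourCounts (allFin m) S
    |counts| : length counts ≡ suc r
    |counts| = trans (length-map _ (allFin m)) (trans (length-tabulate id) m≡1+r)
    pairs : AllPairs (λ x y → n ≤ x * y) counts
    pairs = AllPairsₚ.map⁺ (AllPairs.map (layers≤colourCount*colourCount S geo) (allFin⁺ m))

-- Every colour gets r = r″ + 2 slots, w + 1 rows apart; if sh = 1, the last slot of the last colour is dropped.
module Construction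
  (n m″ r″ w sh : ℕ) .{{_ : NonZero w}} (sh≤1 : sh ≤ 1)
  (n≤r*w : n ≤ suc (suc r″) * w) (w+sh≤r : w + sh ≤ suc (suc r″))
  (rows-above : 2 + r″ * suc w ≤ n) (rows-below : n ≤ suc (suc r″ * suc w))
  (rows-below-omitted : sh ≡ 1 → n ≤ suc (suc r″ * w + r″)) where

  open PathTimesComplete n (suc (suc m″))

  m r top : ℕ
  m = suc (suc m″)
  r = suc (suc r″)
  top = n ∸ 1

  n≡1+top : n ≡ suc top
  n≡1+top = sym (trans (+-comm 1 top) (m∸n+n≡m (≤-trans (s≤s z≤n) rows-above)))

  top<n : top < n
  top<n = ≤-reflexive (sym n≡1+top)

  row≤top : ∀ (g : Fin n) → toℕ g ≤ top
  row≤top g = ≤-pred (subst (toℕ g <_) n≡1+top (toℕ<n g))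

  below-top : r″ * suc w < top
  below-top = ≤-pred (subst (2 + r″ * suc w ≤_) n≡1+top rows-above)

  top-reached : top ≤ suc r″ * suc w
  top-reached = ≤-pred (subst (_≤ suc (suc r″ * suc w)) n≡1+top rows-below)

  omitted-top : sh ≡ 1 → top ≤ suc r″ * w + r″
  omitted-top sh≡1 = ≤-pred (subst (_≤ suc (suc r″ * w + r″)) n≡1+top (rows-below-omitted sh≡1))

  clamp : ℕ → Fin n
  clamp x = fromℕ< (≤-<-trans (m⊓n≤n x top) top<n)

  toℕ-clamp : ∀ x → toℕ (clamp x) ≡ x ⊓ top
  toℕ-clamp x = toℕ-fromℕ< _

  -- Slot q of every colour sits in row q (w + 1); the last slot is pushed to the top row.
  position : Fin r → Fin n
  position q = clamp (toℕ q * suc w)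

  switchRow : Fin r → Fin r → Fin n
  switchRow p q = clamp (toℕ p * w + toℕ q)

  p*w+q-between : ∀ p q → Between (p * suc w) (p * w + q) (q * suc w)
  p*w+q-between p q with ≤-total p q
  ... | inj₁ p≤q = inj₁ (lower p≤q , upper p≤q)
    where
    lower : p ≤ q → p * suc w ≤ p * w + q
    lower p≤q = subst (_≤ p * w + q) (sym (trans (*-suc p w) (+-comm p (p * w)))) (+-monoʳ-≤ (p * w) p≤q)
    upper : p ≤ q → p * w + q ≤ q * suc w
    upper p≤q = subst (p * w + q ≤_) (sym (trans (*-suc q w) (+-comm q (q * w)))) (+-monoˡ-≤ q (*-monoˡ-≤ w p≤q))
  ... | inj₂ q≤p = inj₂ (lower , upper)
    where
    lower : q * suc w ≤ p * w + q
    lower = subst (_≤ p * w + q) (sym (trans (*-suc q w) (+-comm q (q * w)))) (+-monoˡ-≤ q (*-monoˡ-≤ w q≤p))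
    upper : p * w + q ≤ p * suc w
    upper = subst (p * w + q ≤_) (sym (trans (*-suc p w) (+-comm p (p * w)))) (+-monoʳ-≤ (p * w) q≤p)

  switchRow-between : ∀ p q → Between (toℕ (position p)) (toℕ (switchRow p q)) (toℕ (position q))
  switchRow-between p q rewrite toℕ-clamp (toℕ p * suc w) | toℕ-clamp (toℕ p * w + toℕ q) | toℕ-clamp (toℕ q * suc w) =
    Between-⊓ top (p*w+q-between (toℕ p) (toℕ q))

  route : (a : Fin m) (p : Fin r) (b : Fin m) (q : Fin r) → PathBetween G (position p , a) (position q , b)
  route a p b q with a ≟ᶠ b
  ... | yes refl = vertical a (position p) (position q)
  ... | no a≢b   = crossing (position p) (switchRow p q) (position q) a≢b

  route-shortest : ∀ a p b q → IsShortest G (proj₂ (route a p b q))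
  route-shortest a p b q with a ≟ᶠ b
  ... | yes refl = vertical-shortest (proj₂ (vertical a (position p) (position q)))
                     (≤-reflexive (vertical-length a (position p) (position q)))
  ... | no a≢b   = crossing-shortest (proj₂ (crossing (position p) (switchRow p q) (position q) a≢b)) a≢b
                     (≤-reflexive (crossing-length _ _ _ a≢b (switchRow-between p q)))

  size : ℕ
  size = m * r ∸ sh

  size≤m*r : size ≤ m * r
  size≤m*r = m∸n≤m (m * r) sh

  slot : Fin size → Fin m × Fin r
  slot i = remQuot {m} r (inject≤ i size≤m*r)

  vertex : Fin size → Vertex
  vertex i = position (proj₂ (slot i)) , proj₁ (slot i)

  routeAt : (i j : Fin size) → PathBetween G (vertex i) (vertex j)
  routeAt i j = route (proj₁ (slot i)) (proj₂ (slot i)) (proj₁ (slot j)) (proj₂ (slot j))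

  -- Slot p of colour a has index r a + p.
  Present : Fin m → Fin r → Set
  Present a p = r * toℕ a + toℕ p < size

  index : ∀ a p → Present a p → Fin size
  index a p pr = fromℕ< pr

  slot-index : ∀ a p (pr : Present a p) → slot (index a p pr) ≡ (a , p)
  slot-index a p pr = trans (cong (remQuot {m} r) index≡combine) (remQuot-combine a p)
    where
    index≡combine : inject≤ (index a p pr) size≤m*r ≡ combine a p
    index≡combine = toℕ-injective (trans (toℕ-inject≤ (index a p pr) size≤m*r) (trans (toℕ-fromℕ< pr) (sym (toℕ-combine a p))))

  present-if-low : ∀ (a : Fin m) (p : Fin r) → toℕ p + sh < r → Present a p
  present-if-low a p p+sh<r = m+n≤o⇒m≤o∸n (suc (r * toℕ a + toℕ p)) (begin
    suc (r * toℕ a + toℕ p) + sh   ≡⟨ cong suc (trans (+-assoc (r * toℕ a) (toℕ p) sh) (+-comm (r * toℕ a) _)) ⟩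
    suc (toℕ p + sh) + r * toℕ a   ≤⟨ +-monoˡ-≤ (r * toℕ a) p+sh<r ⟩
    r + r * toℕ a                  ≡⟨ sym (*-suc r (toℕ a)) ⟩
    r * suc (toℕ a)                ≤⟨ *-monoʳ-≤ r (toℕ<n a) ⟩
    r * m                          ≡⟨ *-comm r m ⟩
    m * r                          ∎)
    where open ≤-Reasoning

  present-if-not-last : ∀ (a : Fin m) (p : Fin r) → suc (toℕ a) < m → Present a p
  present-if-not-last a p a+1<m = m+n≤o⇒m≤o∸n (suc (r * toℕ a + toℕ p)) (begin
    suc (r * toℕ a + toℕ p) + sh   ≡⟨ cong (_+ sh) (sym (+-suc (r * toℕ a) (toℕ p))) ⟩
    (r * toℕ a + suc (toℕ p)) + sh ≤⟨ +-mono-≤ (+-monoʳ-≤ (r * toℕ a) (toℕ<n p)) (≤-trans sh≤1 (s≤s z≤n)) ⟩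
    (r * toℕ a + r) + r            ≡⟨ cong (_+ r) (trans (+-comm (r * toℕ a) r) (sym (*-suc r (toℕ a)))) ⟩
    r * suc (toℕ a) + r            ≡⟨ trans (+-comm (r * suc (toℕ a)) r) (sym (*-suc r (suc (toℕ a)))) ⟩
    r * suc (suc (toℕ a))          ≤⟨ *-monoʳ-≤ r a+1<m ⟩
    r * m                          ≡⟨ *-comm r m ⟩
    m * r                          ∎)
    where open ≤-Reasoning

  slot-order : ∀ {a b : Fin m} (p q : Fin r) → toℕ a < toℕ b → r * toℕ a + toℕ p < r * toℕ b + toℕ q
  slot-order {a} {b} p q a<b = begin-strict
    r * toℕ a + toℕ p  <⟨ +-monoʳ-< (r * toℕ a) (toℕ<n p) ⟩
    r * toℕ a + r      ≡⟨ trans (+-comm (r * toℕ a) r) (sym (*-suc r (toℕ a))) ⟩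
    r * suc (toℕ a)    ≤⟨ *-monoʳ-≤ r a<b ⟩
    r * toℕ b          ≤⟨ m≤m+n (r * toℕ b) (toℕ q) ⟩
    r * toℕ b + toℕ q  ∎
    where open ≤-Reasoning

  Covered : Vertex → Vertex → Set
  Covered u v = Σ[ i ∈ Fin size ] Σ[ j ∈ Fin size ] toℕ i < toℕ j × EdgeOn G u v (proj₂ (routeAt i j))

  covered-by : ∀ {u v} a p b q (pa : Present a p) (pb : Present b q) → r * toℕ a + toℕ p < r * toℕ b + toℕ q →
    EdgeOn G u v (proj₂ (route a p b q)) → Covered u v
  covered-by {u} {v} a p b q pa pb lt o =
    index a p pa , index b q pb , subst₂ _<_ (sym (toℕ-fromℕ< pa)) (sym (toℕ-fromℕ< pb)) lt ,
    subst₂ (λ (x y : Fin m × Fin r) → EdgeOn G u v (proj₂ (route (proj₁ x) (proj₂ x) (proj₁ y) (proj₂ y))))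
      (sym (slot-index a p pa)) (sym (slot-index b q pb)) o

  Covered-sym : ∀ {u v} → Covered u v → Covered v u
  Covered-sym (i , j , i<j , o) = i , j , i<j , EdgeOn-sym o

  route-via-vertical : ∀ {u v c} p q → EdgeOn G u v (proj₂ (vertical c (position p) (position q))) →
    EdgeOn G u v (proj₂ (route c p c q))
  route-via-vertical {c = c} p q o with c ≟ᶠ c
  ... | yes refl = o
  ... | no c≢c   = contradiction refl c≢c

  route-via-crossing : ∀ {u v a b} p q → a ≢ b →
    (∀ (a≢b : a ≢ b) → EdgeOn G u v (proj₂ (crossing (position p) (switchRow p q) (position q) a≢b))) →
    EdgeOn G u v (proj₂ (route a p b q))
  route-via-crossing {a = a} {b} p q a≢b o with a ≟ᶠ b
  ... | yes a≡b = contradiction a≡b a≢b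
  ... | no a≢b′ = o a≢b′

  -- Row l = p w + q is the switching row of the slots (a , p) and (b , q).
  layer-covered : ∀ (l : Fin n) {a b : Fin m} → toℕ a < toℕ b → Covered (l , a) (l , b)
  layer-covered l {a} {b} a<b =
    covered-by a p b q (present-if-not-last a p (≤-trans (s≤s a<b) (toℕ<n b)))
      (present-if-low b q (subst (λ x → x + sh < r) (sym (toℕ-fromℕ< _)) L%w+sh<r))
      (slot-order p q a<b) (route-via-crossing p q (λ a≡b → <-irrefl (cong toℕ a≡b) a<b) switch)
    where
    L : ℕ
    L = toℕ l
    L≡L/w*w+L%w : L / w * w + L % w ≡ L
    L≡L/w*w+L%w = trans (+-comm (L / w * w) (L % w)) (sym (m≡m%n+[m/n]*n L w))
    L%w+sh<r : L % w + sh < r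
    L%w+sh<r = ≤-trans (+-monoˡ-≤ sh (m%n<n L w)) w+sh≤r
    L/w<r : L / w < r
    L/w<r with L / w <? r
    ... | yes L/w<r = L/w<r
    ... | no L/w≮r = contradiction (begin
      n                  ≤⟨ n≤r*w ⟩
      r * w              ≤⟨ *-monoˡ-≤ w (≮⇒≥ L/w≮r) ⟩
      L / w * w          ≤⟨ m≤m+n (L / w * w) (L % w) ⟩
      L / w * w + L % w  ≡⟨ L≡L/w*w+L%w ⟩
      L                  ∎) (<⇒≱ (toℕ<n l))
      where open ≤-Reasoning
    p q : Fin r
    p = fromℕ< L/w<r
    q = fromℕ< (≤-trans (s≤s (m≤m+n (L % w) sh)) L%w+sh<r)
    switchRow≡l : switchRow p q ≡ l
    switchRow≡l = toℕ-injective (begin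
      toℕ (switchRow p q)              ≡⟨ toℕ-clamp _ ⟩
      (toℕ p * w + toℕ q) ⊓ top        ≡⟨ cong₂ (λ x y → (x * w + y) ⊓ top) (toℕ-fromℕ< L/w<r) (toℕ-fromℕ< _) ⟩
      (L / w * w + L % w) ⊓ top        ≡⟨ cong (_⊓ top) L≡L/w*w+L%w ⟩
      L ⊓ top                          ≡⟨ m≤n⇒m⊓n≡m (row≤top l) ⟩
      L                                ∎)
      where open ≡-Reasoning
    switch : ∀ a≢b → EdgeOn G (l , a) (l , b) (proj₂ (crossing (position p) (switchRow p q) (position q) a≢b))
    switch a≢b = subst (λ g → EdgeOn G (g , a) (g , b) (proj₂ (crossing (position p) (switchRow p q) (position q) a≢b)))
      switchRow≡l (crossing-covers-switch (position p) (switchRow p q) (position q) a≢b)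

  first last penultimate : Fin r
  first = zero
  last = fromℕ (suc r″)
  penultimate = fromℕ< (m<n⇒m<1+n (n<1+n r″))

  toℕ-penultimate : toℕ penultimate ≡ r″
  toℕ-penultimate = toℕ-fromℕ< _

  slot-is-last : ∀ (q : Fin r) → ¬ toℕ q ≤ r″ → toℕ q ≡ suc r″
  slot-is-last q q≰r″ = ≤-antisym (≤-pred (toℕ<n q)) (≰⇒> q≰r″)

  position-first : toℕ (position first) ≡ 0
  position-first = toℕ-clamp 0

  position-top : ∀ q → toℕ q ≡ suc r″ → toℕ (position q) ≡ top
  position-top q q≡1+r″ = trans (toℕ-clamp _) (trans (cong (λ x → x * suc w ⊓ top) q≡1+r″) (m≥n⇒m⊓n≡n top-reached))

  position-last : toℕ (position last) ≡ top
  position-last = position-top last (toℕ-fromℕ (suc r″))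

  position-below-top : ∀ q → toℕ q ≤ r″ → toℕ (position q) ≡ toℕ q * suc w × toℕ q * suc w < top
  position-below-top q q≤r″ = trans (toℕ-clamp _) (m≤n⇒m⊓n≡m (<⇒≤ below)) , below
    where
    below : toℕ q * suc w < top
    below = ≤-<-trans (*-monoˡ-≤ (suc w) q≤r″) below-top

  position-injective : ∀ p q → toℕ (position p) ≡ toℕ (position q) → p ≡ q
  position-injective p q eq with toℕ p ≤? r″ | toℕ q ≤? r″
  ... | yes p≤r″ | yes q≤r″ = toℕ-injective (*-cancelʳ-≡ (toℕ p) (toℕ q) (suc w)
    (trans (sym (proj₁ (position-below-top p p≤r″))) (trans eq (proj₁ (position-below-top q q≤r″)))))
  ... | yes p≤r″ | no q≰r″ = contradiction (trans (sym (proj₁ (position-below-top p p≤r″))) (trans eq (position-top q (slot-is-last q q≰r″))))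
    (<⇒≢ (proj₂ (position-below-top p p≤r″)))
  ... | no p≰r″ | yes q≤r″ = contradiction (trans (sym (proj₁ (position-below-top q q≤r″))) (trans (sym eq) (position-top p (slot-is-last p p≰r″))))
    (<⇒≢ (proj₂ (position-below-top q q≤r″)))
  ... | no p≰r″ | no q≰r″ = toℕ-injective (trans (slot-is-last p p≰r″) (sym (slot-is-last q q≰r″)))

  present-first : ∀ a → Present a first
  present-first a = present-if-low a first (s≤s (≤-trans sh≤1 (s≤s z≤n)))

  present-penultimate : ∀ a → Present a penultimate
  present-penultimate a = present-if-low a penultimate
    (subst (λ x → x + sh < r) (sym toℕ-penultimate) (s≤s (≤-trans (+-monoʳ-≤ r″ sh≤1) (≤-reflexive (+-comm r″ 1)))))

  lastColour : Fin m
  lastColour = fromℕ (suc m″)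

  vertical-between-slots : ∀ c p q (g g′ : Fin n) → suc (toℕ g) ≡ toℕ g′ → toℕ (position p) ≤ toℕ g → toℕ g′ ≤ toℕ (position q) →
    EdgeOn G (g , c) (g′ , c) (proj₂ (route c p c q))
  vertical-between-slots c p q g g′ g+1≡g′ p≤g g′≤q =
    route-via-vertical p q (vertical-covers c (position p) (position q) g g′ g+1≡g′ (inj₁ (p≤g , g′≤q)))

  column-covered : ∀ c (g g′ : Fin n) → suc (toℕ g) ≡ toℕ g′ → Present c last → Covered (g , c) (g′ , c)
  column-covered c g g′ g+1≡g′ present-last =
    covered-by c first c last (present-first c) present-last (+-monoʳ-< (r * toℕ c) (subst (0 <_) (sym (toℕ-fromℕ _)) (s≤s z≤n)))
      (vertical-between-slots c first last g g′ g+1≡g′ (subst (_≤ toℕ g) (sym position-first) z≤n)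
        (subst (toℕ g′ ≤_) (sym position-last) (row≤top g′)))

  -- Without the slot (lastColour , last), the top of the last column is reached from slot last of colour 0,
  -- whose path to the penultimate slot switches colour in the top row.
  truncated-column-covered : sh ≡ 1 → ∀ (g g′ : Fin n) → suc (toℕ g) ≡ toℕ g′ → Covered (g , lastColour) (g′ , lastColour)
  truncated-column-covered sh≡1 g g′ g+1≡g′ with toℕ g′ ≤? toℕ (position penultimate)
  ... | yes g′≤penultimate =
    covered-by c first c penultimate (present-first c) (present-penultimate c) (+-monoʳ-< (r * toℕ c) 0<penultimate)
      (vertical-between-slots c first penultimate g g′ g+1≡g′ (subst (_≤ toℕ g) (sym position-first) z≤n) g′≤penultimate)
    where
    c : Fin m
    c = lastColour
    0<penultimate : 0 < toℕ penultimate
    0<penultimate with toℕ penultimate ≟ 0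
    ... | no ≢0 = n≢0⇒n>0 ≢0
    ... | yes ≡0 = contradiction (subst (toℕ g′ ≤_) (trans (toℕ-clamp _) (cong (λ x → x * suc w ⊓ top) ≡0)) g′≤penultimate)
                     (subst (λ x → ¬ x ≤ 0) g+1≡g′ λ ())
  ... | no g′≰penultimate =
    covered-by zero last c penultimate (present-if-not-last zero last (s≤s (s≤s z≤n))) (present-penultimate c)
      (slot-order last penultimate (subst (0 <_) (sym (toℕ-fromℕ (suc m″))) (s≤s z≤n)))
      (route-via-crossing last penultimate (λ ()) second-leg)
    where
    c : Fin m
    c = lastColour
    switch-top : toℕ (switchRow last penultimate) ≡ top
    switch-top = trans (toℕ-clamp _) (trans (cong₂ (λ x y → (x * w + y) ⊓ top) (toℕ-fromℕ (suc r″)) toℕ-penultimate)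
                   (m≥n⇒m⊓n≡n (omitted-top sh≡1)))
    second-leg : ∀ 0≢c → EdgeOn G (g , c) (g′ , c) (proj₂ (crossing (position last) (switchRow last penultimate) (position penultimate) 0≢c))
    second-leg 0≢c = crossing-covers-second-leg _ _ _ 0≢c g g′ g+1≡g′
      (inj₂ (≤-pred (≤-trans (≰⇒> g′≰penultimate) (≤-reflexive (sym g+1≡g′))) , subst (toℕ g′ ≤_) (sym switch-top) (row≤top g′)))

  vertical-edge-covered : ∀ c (g g′ : Fin n) → suc (toℕ g) ≡ toℕ g′ → Covered (g , c) (g′ , c)
  vertical-edge-covered c g g′ g+1≡g′ with sh ≟ 0 | c ≟ᶠ lastColour
  ... | yes sh≡0 | _ = column-covered c g g′ g+1≡g′
    (present-if-low c last (subst₂ (λ x y → x + y < r) (sym (toℕ-fromℕ (suc r″))) (sym sh≡0) (≤-reflexive (+-comm (suc (suc r″)) 0))))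
  ... | no sh≢0 | yes refl = truncated-column-covered (≤-antisym sh≤1 (n≢0⇒n>0 sh≢0)) g g′ g+1≡g′
  ... | no _ | no c≢last = column-covered c g g′ g+1≡g′ (present-if-not-last c last (s≤s (≤∧≢⇒< (≤-pred (toℕ<n c)) toℕc≢1+m″)))
    where
    toℕc≢1+m″ : toℕ c ≢ suc m″
    toℕc≢1+m″ e = c≢last (toℕ-injective (trans e (sym (toℕ-fromℕ (suc m″)))))

  all-edges-covered : ∀ u v → Adj G u v → Covered u v
  all-edges-covered (g , c) (_ , c′) (inj₁ (refl , c≢c′)) with <-cmp (toℕ c) (toℕ c′)
  ... | tri< c<c′ _ _ = layer-covered g c<c′
  ... | tri≈ _ c≡c′ _ = contradiction (toℕ-injective c≡c′) c≢c′
  ... | tri> _ _ c>c′ = Covered-sym (layer-covered g c>c′)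
  all-edges-covered (g , c) (g′ , _) (inj₂ (refl , inj₁ g+1≡g′)) = vertical-edge-covered c g g′ g+1≡g′
  all-edges-covered (g , c) (g′ , _) (inj₂ (refl , inj₂ g′+1≡g)) = Covered-sym (vertical-edge-covered c g′ g g′+1≡g)

  vertex-injective : ∀ {i j} → vertex i ≡ vertex j → i ≡ j
  vertex-injective {i} {j} eq = toℕ-injective (begin
    toℕ i                        ≡⟨ sym (toℕ-inject≤ i size≤m*r) ⟩
    toℕ (inject≤ i size≤m*r)     ≡⟨ cong toℕ (injected-equal) ⟩
    toℕ (inject≤ j size≤m*r)     ≡⟨ toℕ-inject≤ j size≤m*r ⟩
    toℕ j                        ∎)
    where
    open ≡-Reasoning
    same-slot : slot i ≡ slot j
    same-slot = cong₂ _,_ (cong proj₂ eq) (position-injective _ _ (cong (toℕ ∘ proj₁) eq))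
    injected-equal : inject≤ i size≤m*r ≡ inject≤ j size≤m*r
    injected-equal = trans (sym (combine-remQuot {m} r _)) (trans (cong (uncurry combine) same-slot) (combine-remQuot {m} r _))

  sge-witness : SgeWitness G (m * r ∸ sh)
  sge-witness =
    tabulate vertex ,
    tabulate-isStrongEdgeGeodetic G vertex vertex-injective routeAt (λ i j → route-shortest _ _ _ _) all-edges-covered ,
    length-tabulate vertex

sge-perfectSquare-witness : ∀ {m k} → 2 ≤ m → 2 ≤ k → SgeWitness (P (k * k) □ K m) (m * k)
sge-perfectSquare-witness {suc (suc m″)} {k@(suc (suc k₂))} (s≤s (s≤s _)) (s≤s (s≤s _)) =
  Construction.sge-witness (k * k) m″ k₂ k 0 z≤n ≤-refl (≤-reflexive (+-identityʳ k))
    (m+n≡o⇒m≤o (e₁ k₂)) (≤-reflexive (e₂ k₂)) (λ ())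
  where
  e₁ : ∀ k₂ → 2 + k₂ * suc (suc (suc k₂)) + (2 + k₂) ≡ suc (suc k₂) * suc (suc k₂)
  e₁ = solve-∀
  e₂ : ∀ k₂ → suc (suc k₂) * suc (suc k₂) ≡ suc (suc k₂ * suc (suc (suc k₂)))
  e₂ = solve-∀

sge-perfectSquare-lowerBound : ∀ {m k} → 2 ≤ m → 1 ≤ k → SgeLowerBound (P (k * k) □ K m) (m * k)
sge-perfectSquare-lowerBound {suc r} {k@(suc k₁)} (s≤s 1≤r) _ S geo = subst (_≤ length S) (+-comm (r * k) k)
  (PathTimesComplete.sge-lowerBound (k * k) (suc r) refl 1≤r ≤-refl ≤-refl (n≤1+n k)
    (λ {t} {y} _ → s²<4N∧N≤xy⇒s<x+y {k₁ + k} t y (m+1+n≡o⇒m<o (e k₁))) S geo)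
  where
  e : ∀ k₁ → (k₁ + suc k₁) * (k₁ + suc k₁) + suc (4 * k₁ + 2) ≡ 4 * (suc k₁ * suc k₁)
  e = solve-∀

sge-shortExcess-witness : ∀ {m k h} → 2 ≤ m → 1 ≤ h → h ≤ k → SgeWitness (P (k * k + h) □ K m) (m * k + (m ∸ 1))
sge-shortExcess-witness {_} {zero} _ 1≤h h≤0 = contradiction (≤-trans 1≤h h≤0) λ ()
sge-shortExcess-witness {m@(suc (suc m″))} {k@(suc k₁)} {h} (s≤s (s≤s _)) 1≤h h≤k =
  subst (SgeWitness _) (size m″ k₁) (Construction.sge-witness (k * k + h) m″ k₁ k 1 ≤-refl
    (≤-trans (+-monoʳ-≤ (k * k) h≤k) (≤-reflexive (+-comm (k * k) k))) (≤-reflexive (+-comm k 1))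
    (≤-trans (≤-reflexive (e₁ k₁)) (+-monoʳ-≤ (k * k) 1≤h))
    (≤-trans (+-monoʳ-≤ (k * k) (m≤n⇒m≤1+n h≤k)) (≤-reflexive (e₂ k₁)))
    (λ _ → ≤-trans (+-monoʳ-≤ (k * k) h≤k) (≤-reflexive (e₃ k₁))))
  where
  e₁ : ∀ k₁ → 2 + k₁ * suc (suc k₁) ≡ suc k₁ * suc k₁ + 1
  e₁ = solve-∀
  e₂ : ∀ k₁ → suc k₁ * suc k₁ + suc (suc k₁) ≡ suc (suc k₁ * suc (suc k₁))
  e₂ = solve-∀
  e₃ : ∀ k₁ → suc k₁ * suc k₁ + suc k₁ ≡ suc (suc k₁ * suc k₁ + k₁)
  e₃ = solve-∀
  -- The left-hand side is m (k + 1) ∸ 1 after reducing the truncated subtraction.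
  size : ∀ m″ k₁ → suc k₁ + suc m″ * suc (suc k₁) ≡ suc (suc m″) * suc k₁ + suc m″
  size = solve-∀

sge-shortExcess-lowerBound : ∀ {m k h} → 2 ≤ m → 1 ≤ h → SgeLowerBound (P (k * k + h) □ K m) (m * k + (m ∸ 1))
sge-shortExcess-lowerBound {suc r} {k} {h} (s≤s 1≤r) 1≤h S geo = subst (_≤ length S) (e r k)
  (PathTimesComplete.sge-lowerBound (k * k + h) (suc r) refl 1≤r ≤-refl (n≤1+n k) ≤-refl
    (λ {t} {y} _ n≤ty → s²<4N∧N≤xy⇒s<x+y {k + k} t y (m+1+n≡o⇒m<o (e′ k)) (≤-trans (+-monoʳ-≤ (k * k) 1≤h) n≤ty)) S geo)
  where
  e : ∀ r k → r * suc k + k ≡ suc r * k + r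
  e = solve-∀
  e′ : ∀ k → (k + k) * (k + k) + 4 ≡ 4 * (k * k + 1)
  e′ = solve-∀

sge-longExcess-witness : ∀ {m k h} → 2 ≤ m → k + 1 ≤ h → h ≤ 2 * k → SgeWitness (P (k * k + h) □ K m) (m * k + m)
sge-longExcess-witness {_} {zero} _ (s≤s _) ()
sge-longExcess-witness {m@(suc (suc m″))} {k@(suc k₁)} {h} (s≤s (s≤s _)) k+1≤h h≤2k =
  subst (SgeWitness _) (trans (*-suc m k) (+-comm m (m * k))) (Construction.sge-witness (k * k + h) m″ k₁ (suc k) 0 z≤n
    (≤-trans (+-monoʳ-≤ (k * k) (m≤n⇒m≤1+n h≤2k)) (≤-reflexive (e₁ k₁))) (≤-reflexive (+-identityʳ (suc k)))
    (≤-trans (≤-reflexive (e₂ k₁)) (+-monoʳ-≤ (k * k) (≤-trans (n≤1+n k) (subst (_≤ h) (+-comm k 1) k+1≤h))))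
    (≤-trans (+-monoʳ-≤ (k * k) (m≤n⇒m≤1+n h≤2k)) (≤-reflexive (e₃ k₁)))
    (λ ()))
  where
  e₁ : ∀ k₁ → suc k₁ * suc k₁ + suc (2 * suc k₁) ≡ suc (suc k₁) * suc (suc k₁)
  e₁ = solve-∀
  e₂ : ∀ k₁ → 2 + k₁ * suc (suc (suc k₁)) ≡ suc k₁ * suc k₁ + suc k₁
  e₂ = solve-∀
  e₃ : ∀ k₁ → suc k₁ * suc k₁ + suc (2 * suc k₁) ≡ suc (suc k₁ * suc (suc (suc k₁)))
  e₃ = solve-∀

sge-longExcess-lowerBound : ∀ {m k h} → 2 ≤ m → k + 1 ≤ h → SgeLowerBound (P (k * k + h) □ K m) (m * k + m)
sge-longExcess-lowerBound {suc r} {k} {h} (s≤s 1≤r) k+1≤h S geo = subst (_≤ length S) (e r k)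
  (PathTimesComplete.sge-lowerBound (k * k + h) (suc r) refl 1≤r ≤-refl ≤-refl (n≤1+n (suc k))
    (λ {t} {y} _ n≤ty → s²<4N∧N≤xy⇒s<x+y {k + suc k} t y (m+1+n≡o⇒m<o (e′ k)) (≤-trans (+-monoʳ-≤ (k * k) k+1≤h) n≤ty)) S geo)
  where
  e : ∀ r k → r * suc k + suc k ≡ suc r * k + suc r
  e = solve-∀
  e′ : ∀ k → (k + suc k) * (k + suc k) + 3 ≡ 4 * (k * k + (k + 1))
  e′ = solve-∀

2≤k*k⇒2≤k : ∀ {k} → 2 ≤ k * k → 2 ≤ k
2≤k*k⇒2≤k {zero}        ()
2≤k*k⇒2≤k {suc zero}    (s≤s ())
2≤k*k⇒2≤k {suc (suc _)} _ = s≤s (s≤s z≤n)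

theorem3p5 : (m n k h : ℕ) → 3 ≤ m → 2 ≤ n → 1 ≤ k → n ≡ k * k + h → h ≤ 2 * k →
    (h ≡ 0 → SgeIs (P n □ K m) (m * k))
    × (1 ≤ h → h ≤ k → SgeIs (P n □ K m) (m * k + (m ∸ 1)))
    × (k + 1 ≤ h → SgeIs (P n □ K m) (m * k + m))
theorem3p5 m n k h 3≤m 2≤n 1≤k refl h≤2k = perfectSquare , shortExcess , longExcess
  where
  2≤m : 2 ≤ m
  2≤m = ≤-trans (n≤1+n 2) 3≤m
  perfectSquare : h ≡ 0 → SgeIs (P (k * k + h) □ K m) (m * k)
  perfectSquare refl = subst (λ n → SgeIs (P n □ K m) (m * k)) (sym (+-identityʳ (k * k)))
    (sge-perfectSquare-witness 2≤m (2≤k*k⇒2≤k (subst (2 ≤_) (+-identityʳ (k * k)) 2≤n)) ,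
     sge-perfectSquare-lowerBound 2≤m 1≤k)
  shortExcess : 1 ≤ h → h ≤ k → SgeIs (P (k * k + h) □ K m) (m * k + (m ∸ 1))
  shortExcess 1≤h h≤k = sge-shortExcess-witness 2≤m 1≤h h≤k , sge-shortExcess-lowerBound 2≤m 1≤h
  longExcess : k + 1 ≤ h → SgeIs (P (k * k + h) □ K m) (m * k + m)
  longExcess k+1≤h = sge-longExcess-witness 2≤m k+1≤h h≤2k , sge-longExcess-lowerBound 2≤m k+1≤h
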